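{- Let $A\in\mathbb{Z}^{m\times n}$ and $b_1,\dots,b_k\in\mathbb{Z}^n$. The following are equivalent: (1) for every finite coloring $c$ of $\mathbb{N}$ and every $r\in\mathbb{N}$ there is $\vec t\in\mathbb{N}^n$ with $c(t_1)=\dots=c(t_n)$, $A\vec t=0$ and $b_i\cdot\vec t>r$ for all $i\in\{1,\dots,k\}$ (i.e. the system $A\vec t=0$, $b_i\cdot\vec t\gg0$ is partition regular over $\mathbb{N}$); (2) for every finite coloring $c$ of $\mathbb{N}$ there is $\vec t\in\mathbb{N}^n$ with $c(t_1)=\dots=c(t_n)$, $A\vec t=0$ and $b_i\cdot\vec t>0$ for all $i\in\{1,\dots,k\}$. -}

module Defs where

open import Data.Nat using (ℕ; zero; suc)
open import Data.Fin using (Fin; zero; suc)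
open import Data.Integer using (ℤ; +_; _+_; _*_)

dot : (n : ℕ) → (Fin n → ℤ) → (Fin n → ℕ) → ℤ
dot zero    b t = + 0
dot (suc n) b t = b zero * + (t zero) + dot n (λ i → b (suc i)) (λ i → t (suc i))

-- Scaling is the whole argument: if t is a monochromatic solution for the
-- colouring x ↦ c ((1 + r) x), then (1 + r) t is a monochromatic solution for
-- c of the same homogeneous system, and each b_i · t ≥ 1 becomes ≥ 1 + r.
module Submission where

open import Defs
open import Data.Nat using (ℕ; _≤_; suc; zero)
import Data.Nat as ℕ
import Data.Nat.Properties as ℕP
open import Data.Fin using (Fin)
open import Data.Integer using (ℤ; +_; _<_; +<+; _+_; _*_)
import Data.Integer.Properties as ℤP
open import Data.Product using (Σ; _×_; _,_)
open import Relation.Binary.PropositionalEquality using (_≡_; cong; cong₂; sym; module ≡-Reasoning)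
open import Function.Bundles using (_⇔_; mk⇔)

dot-scale : (n : ℕ) (a : Fin n → ℤ) (t : Fin n → ℕ) (s : ℕ) →
  dot n a (λ i → s ℕ.* t i) ≡ + s * dot n a t
dot-scale zero a t s = sym (ℤP.*-zeroʳ (+ s))
dot-scale (suc n) a t s = begin
  a₀ * + (s ℕ.* t₀) + dot n a′ (λ i → s ℕ.* t′ i) ≡⟨ cong₂ _+_ head (dot-scale n a′ t′ s) ⟩
  + s * (a₀ * + t₀) + + s * dot n a′ t′            ≡⟨ ℤP.*-distribˡ-+ (+ s) (a₀ * + t₀) _ ⟨
  + s * (a₀ * + t₀ + dot n a′ t′)                  ∎
  where
  open ≡-Reasoning
  a₀ = a Fin.zero
  t₀ = t Fin.zero
  a′ = λ i → a (Fin.suc i)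
  t′ = λ i → t (Fin.suc i)
  head : a₀ * + (s ℕ.* t₀) ≡ + s * (a₀ * + t₀)
  head = begin
    a₀ * + (s ℕ.* t₀) ≡⟨ cong (a₀ *_) (ℤP.pos-* s t₀) ⟩
    a₀ * (+ s * + t₀) ≡⟨ ℤP.*-assoc a₀ (+ s) (+ t₀) ⟨
    a₀ * + s * + t₀   ≡⟨ cong (_* + t₀) (ℤP.*-comm a₀ (+ s)) ⟩
    + s * a₀ * + t₀   ≡⟨ ℤP.*-assoc (+ s) a₀ (+ t₀) ⟩
    + s * (a₀ * + t₀) ∎

+r<+[1+r]*x : (r : ℕ) {x : ℤ} → + 0 < x → + r < + suc r * x
+r<+[1+r]*x r {+ suc y} _ = +<+ (ℕP.m≤m*n (suc r) (suc y))
+r<+[1+r]*x r {+ zero} (+<+ ())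

module _ {m n k : ℕ} (A : Fin m → Fin n → ℤ) (b : Fin k → Fin n → ℤ) where

  MonochromaticSolution : {q : ℕ} → (ℕ → Fin q) → ℤ → Set
  MonochromaticSolution c bound = Σ (Fin n → ℕ) (λ t →
    ((i : Fin n) → 1 ≤ t i) ×
    ((i j : Fin n) → c (t i) ≡ c (t j)) ×
    ((row : Fin m) → dot n (A row) t ≡ + 0) ×
    ((i : Fin k) → bound < dot n (b i) t))

  scale-solution : {q : ℕ} (c : ℕ → Fin q) (r : ℕ) →
    MonochromaticSolution (λ x → c (suc r ℕ.* x)) (+ 0) → MonochromaticSolution c (+ r)
  scale-solution c r (t , positive , monochromatic , homogeneous , large) =
    (λ i → suc r ℕ.* t i) ,
    (λ i → ℕP.≤-trans (positive i) (ℕP.m≤n*m (t i) (suc r))) ,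
    monochromatic ,
    (λ row → begin
      dot n (A row) (λ i → suc r ℕ.* t i) ≡⟨ dot-scale n (A row) t (suc r) ⟩
      + suc r * dot n (A row) t           ≡⟨ cong (+ suc r *_) (homogeneous row) ⟩
      + suc r * + 0                       ≡⟨ ℤP.*-zeroʳ (+ suc r) ⟩
      + 0                                 ∎) ,
    (λ i → ℤP.<-≤-trans (+r<+[1+r]*x r (large i))
             (ℤP.≤-reflexive (sym (dot-scale n (b i) t (suc r)))))
    where open ≡-Reasoning

lemma2p16 : (m n k : ℕ) (A : Fin m → Fin n → ℤ) (b : Fin k → Fin n → ℤ) →
    ((q : ℕ) (c : ℕ → Fin q) (r : ℕ) →
      Σ (Fin n → ℕ) (λ t →
        ((i : Fin n) → 1 ≤ t i) ×
        ((i j : Fin n) → c (t i) ≡ c (t j)) ×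
        ((row : Fin m) → dot n (A row) t ≡ + 0) ×
        ((i : Fin k) → + r < dot n (b i) t)))
    ⇔
    ((q : ℕ) (c : ℕ → Fin q) →
      Σ (Fin n → ℕ) (λ t →
        ((i : Fin n) → 1 ≤ t i) ×
        ((i j : Fin n) → c (t i) ≡ c (t j)) ×
        ((row : Fin m) → dot n (A row) t ≡ + 0) ×
        ((i : Fin k) → + 0 < dot n (b i) t)))
lemma2p16 m n k A b = mk⇔
  (λ large q c → large q c 0)
  (λ positive q c r → scale-solution A b c r (positive q (λ x → c (suc r ℕ.* x))))
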